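{- For every positive integer $n$, $W(Q_n)\leq \frac{n(n+1)}{2}$.
   Context: All graphs are finite, undirected, without loops or multiple edges. An edge-coloring of a graph $G$ with colors $1,\ldots,t$ is an interval $t$-coloring if all $t$ colors are used, and the colors of the edges incident to each vertex are distinct and form an interval of consecutive integers; $W(G)$ is the greatest $t$ for which $G$ has an interval $t$-coloring. $Q_n$ is the $n$-dimensional hypercube (Cartesian product of $n$ copies of $K_2$), which is interval colorable. -}

module Defs where

open import Data.Nat using (ℕ; zero; suc; _≤_; _*_; _/_)
open import Data.Unit using (⊤; tt)
open import Data.Empty using (⊥)
open import Data.Bool using (Bool; true; false)
open import Data.Product using (_×_; Σ; ∃; ∃-syntax; _,_)
open import Data.Sum using (_⊎_; inj₁; inj₂)
import Relation.Binary.PropositionalEquality as Eq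
open import Relation.Binary.PropositionalEquality using (_≡_; _≢_)
open import Relation.Nullary using (¬_)

record Graph : Set₁ where
  field
    Vertex : Set
    Adj    : Vertex → Vertex → Set
    sym    : ∀ {u v} → Adj u v → Adj v u
    irrefl : ∀ {u} → ¬ Adj u u
open Graph public

K₁ : Graph
K₁ = record { Vertex = ⊤ ; Adj = λ _ _ → ⊥ ; sym = λ () ; irrefl = λ () }

K₂Adj : Bool → Bool → Set
K₂Adj a b = ¬ (a ≡ b)

K₂ : Graph
K₂ = record
  { Vertex = Bool
  ; Adj = K₂Adj
  ; sym = λ ne eq → ne (Relation.Binary.PropositionalEquality.sym eq)
  ; irrefl = λ ne → ne Relation.Binary.PropositionalEquality.refl
  }

□Adj : (G H : Graph) → Vertex G × Vertex H → Vertex G × Vertex H → Set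
□Adj G H (u , x) (v , y) = (Adj G u v × x ≡ y) ⊎ (u ≡ v × Adj H x y)

□sym : (G H : Graph) → ∀ {p q} → □Adj G H p q → □Adj G H q p
□sym G H {u , x} {v , y} (inj₁ (a , e)) = inj₁ (Graph.sym G a , Eq.sym e)
□sym G H {u , x} {v , y} (inj₂ (e , a)) = inj₂ (Eq.sym e , Graph.sym H a)

□irr : (G H : Graph) → ∀ {p} → ¬ □Adj G H p p
□irr G H {u , x} (inj₁ (a , _)) = Graph.irrefl G a
□irr G H {u , x} (inj₂ (_ , a)) = Graph.irrefl H a

_□_ : Graph → Graph → Graph
G □ H = record
  { Vertex = Vertex G × Vertex H
  ; Adj = □Adj G H
  ; sym = □sym G H
  ; irrefl = □irr G H
  }

Q : ℕ → Graph
Q zero    = K₁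
Q (suc n) = Q n □ K₂

-- An interval t-coloring of G. The edge-coloring is given as a symmetric
-- function col on ordered pairs of vertices; only its values on adjacent
-- pairs (i.e. on edges) matter.
record IntervalColoring (G : Graph) (t : ℕ) : Set where
  field
    col      : Vertex G → Vertex G → ℕ
    col-sym  : ∀ u v → Adj G u v → col u v ≡ col v u
    range    : ∀ u v → Adj G u v → 1 ≤ col u v × col u v ≤ t
    surj     : ∀ k → 1 ≤ k → k ≤ t → ∃[ u ] ∃[ v ] (Adj G u v × col u v ≡ k)
    proper   : ∀ u v w → Adj G u v → Adj G u w → v ≢ w → col u v ≢ col u w
    interval : ∀ u v w k → Adj G u v → Adj G u w →
               col u v ≤ k → k ≤ col u w →
               ∃[ x ] (Adj G u x × col u x ≡ k)

-- W G ≤ m : every interval t-coloring of G has t ≤ m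
-- (i.e. the greatest such t, which exists for interval colorable G, is ≤ m).
W≤ : Graph → ℕ → Set
W≤ G m = ∀ t → IntervalColoring G t → t ≤ m

module Submission where

-- Fix an interval t-colouring of Q N and a vertex a incident to an edge of
-- colour 1.  Two local facts drive the proof:
--   * at a vertex of degree at most N the colours form an interval of at
--     most N values, so any two incident colours differ by less than N;
--   * among k+1 distinct naturals bounded by M, one is at most M - k.
-- A vertex v at Hamming distance k+1 from a has k+1 neighbours at distance
-- k from a, joined to v by edges of distinct colours.  By induction on the
-- distance, every edge at a vertex at distance k has colour at most
-- (k+1)N - k(k+1)/2.  Since this bound is largest at k = N, where it equals
-- N(N+1)/2, every colour, in particular t, is at most N(N+1)/2.

open import Defs
open import Data.Nat using (ℕ; zero; suc; _+_; _*_; _∸_; _/_; _≤_; _<_; z≤n; s≤s; _≤?_)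
open import Data.Nat.Properties
open import Data.Nat.DivMod using (m*n/n≡m)
open import Data.Nat.Solver using (module +-*-Solver)
open +-*-Solver using (solve; _:+_; _:*_; _:=_; con)
open import Data.Fin as F using (Fin; toℕ; fromℕ<)
import Data.Fin.Properties as FP
open import Data.Bool using (Bool; true; false; not)
open import Data.Bool.Properties using (not-¬; ¬-not)
open import Data.Product using (Σ-syntax; ∃-syntax; _×_; _,_; proj₁; proj₂)
open import Data.Sum using (inj₁; inj₂)
open import Data.Unit using (tt)
open import Function using (_∘_)
open import Function.Definitions using (Injective)
open import Relation.Nullary using (yes; no; contradiction)
open import Relation.Binary.PropositionalEquality
  using (_≡_; refl; cong; subst; module ≡-Reasoning)
  renaming (sym to ≡-sym; trans to ≡-trans)

tri : ℕ → ℕ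
tri zero    = 0
tri (suc k) = suc k + tri k

tri-double : ∀ k → tri k + tri k ≡ k + k * k
tri-double zero    = refl
tri-double (suc k) = begin
  (suc k + tri k) + (suc k + tri k) ≡⟨ solve 2 (λ k s → (con 1 :+ k :+ s) :+ (con 1 :+ k :+ s)
                                         := con 2 :+ k :+ k :+ (s :+ s)) refl k (tri k) ⟩
  2 + k + k + (tri k + tri k)       ≡⟨ cong (2 + k + k +_) (tri-double k) ⟩
  2 + k + k + (k + k * k)           ≡⟨ solve 1 (λ k → con 2 :+ k :+ k :+ (k :+ k :* k)
                                         := (con 1 :+ k) :+ (con 1 :+ k) :* (con 1 :+ k)) refl k ⟩
  suc k + suc k * suc k             ∎
  where open ≡-Reasoning

tri-div : ∀ k → (k * suc k) / 2 ≡ tri k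
tri-div k = begin
  (k * suc k) / 2        ≡⟨ cong (_/ 2) (*-suc k k) ⟩
  (k + k * k) / 2        ≡⟨ cong (_/ 2) (≡-sym (tri-double k)) ⟩
  (tri k + tri k) / 2    ≡⟨ cong (_/ 2) (+-*-Solver.solve 1 (λ x → x :+ x := x :* con 2) refl (tri k)) ⟩
  (tri k * 2) / 2        ≡⟨ m*n/n≡m (tri k) 2 ⟩
  tri k                  ∎
  where open ≡-Reasoning

tri-+ : ∀ d e → tri (d + e) ≡ tri d + tri e + d * e
tri-+ zero    e = ≡-sym (+-identityʳ (tri e))
tri-+ (suc d) e = begin
  suc (d + e) + tri (d + e)          ≡⟨ cong (suc (d + e) +_) (tri-+ d e) ⟩
  suc (d + e) + (tri d + tri e + d * e)
    ≡⟨ solve 4 (λ d e s t → (con 1 :+ (d :+ e)) :+ (s :+ t :+ d :* e)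
                 := (con 1 :+ d :+ s) :+ t :+ (con 1 :+ d) :* e) refl d e (tri d) (tri e) ⟩
  (suc d + tri d) + tri e + suc d * e ∎
  where open ≡-Reasoning

n≤tri : ∀ n → n ≤ tri n
n≤tri zero    = z≤n
n≤tri (suc n) = m≤m+n (suc n) (tri n)

-- The distance bound (k+1)N - tri k is maximal at k = N (for k ≤ N):
-- (k+1) N ≤ tri k + tri N.
peak : ∀ {k N} → k ≤ N → suc k * N ≤ tri k + tri N
peak {k} {N} k≤N = subst (λ M → suc k * M ≤ tri k + tri M) (m+[n∸m]≡n k≤N) (go (N ∸ k))
  where
  open ≤-Reasoning
  go : ∀ e → suc k * (k + e) ≤ tri k + tri (k + e)
  go e = begin
    suc k * (k + e)                      ≡⟨ solve 2 (λ k e → (con 1 :+ k) :* (k :+ e)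
                                              := e :+ (k :+ k :* k) :+ k :* e) refl k e ⟩
    e + (k + k * k) + k * e              ≤⟨ +-monoˡ-≤ (k * e) (+-monoˡ-≤ (k + k * k) (n≤tri e)) ⟩
    tri e + (k + k * k) + k * e          ≡⟨ cong (λ x → tri e + x + k * e) (≡-sym (tri-double k)) ⟩
    tri e + (tri k + tri k) + k * e      ≡⟨ solve 3 (λ s t p → t :+ (s :+ s) :+ p
                                              := s :+ (s :+ t :+ p)) refl (tri k) (tri e) (k * e) ⟩
    tri k + (tri k + tri e + k * e)      ≡⟨ cong (tri k +_) (≡-sym (tri-+ k e)) ⟩
    tri k + tri (k + e)                  ∎

spread-of-distinct : ∀ {k M} (c : Fin (suc k) → ℕ) → Injective _≡_ _≡_ c →
                     (∀ j → c j ≤ M) → ∃[ j ] (c j + k ≤ M)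
spread-of-distinct {k} {M} c c-inj c≤M with FP.any? (λ j → c j + k ≤? M)
... | yes found = found
... | no none   = contradiction (FP.injective⇒≤ gap-inj) (n≮n k)
  where
  -- Otherwise every gap M - c j is below k, and distinct c j give distinct gaps.
  gap< : ∀ j → M ∸ c j < k
  gap< j = ≰⇒> λ k≤gap → none (j , ≤-trans (+-monoʳ-≤ (c j) k≤gap) (≤-reflexive (m+[n∸m]≡n (c≤M j))))
  gap : Fin (suc k) → Fin k
  gap j = fromℕ< (gap< j)
  gap-inj : Injective _≡_ _≡_ gap
  gap-inj {i} {j} eq = c-inj (∸-cancelˡ-≡ (c≤M i) (c≤M j)
    (≡-trans (≡-sym (FP.toℕ-fromℕ< (gap< i))) (≡-trans (cong toℕ eq) (FP.toℕ-fromℕ< (gap< j)))))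

DegreeAtMost : Graph → ℕ → Set
DegreeAtMost G N = ∀ u → Σ[ code ∈ (∀ {x} → Adj G u x → Fin N) ]
                     (∀ {x y} (p : Adj G u x) (q : Adj G u y) → code p ≡ code q → x ≡ y)

-- In an interval colouring of a graph of maximum degree N, any two colours
-- at a vertex differ by less than N: otherwise the N+1 colours
-- col u v, …, col u v + N would all occur at u.
colour-spread : ∀ {G N t} → DegreeAtMost G N → (C : IntervalColoring G t) →
                let open IntervalColoring C in
                ∀ {u v w} → Adj G u v → Adj G u w → col u w < col u v + N
colour-spread {G} {N} deg C {u} {v} {w} uv uw with col u v + N ≤? col u w
  where open IntervalColoring C
... | no  ≰ = ≰⇒> ≰
... | yes wide = contradiction (FP.injective⇒≤ realiser-inj) (n≮n N)
  where
  open IntervalColoring C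
  code : ∀ {x} → Adj G u x → Fin N
  code = proj₁ (deg u)
  realiser : (j : Fin (suc N)) → ∃[ x ] (Adj G u x × col u x ≡ col u v + toℕ j)
  realiser j = interval u v w _ uv uw (m≤m+n _ _)
                 (≤-trans (+-monoʳ-≤ (col u v) (FP.toℕ≤pred[n] j)) wide)
  realiser-code : Fin (suc N) → Fin N
  realiser-code j = code (proj₁ (proj₂ (realiser j)))
  realiser-inj : Injective _≡_ _≡_ realiser-code
  realiser-inj {i} {j} eq = FP.toℕ-injective (+-cancelˡ-≡ (col u v) _ _ (begin
    col u v + toℕ i        ≡⟨ ≡-sym (proj₂ (proj₂ (realiser i))) ⟩
    col u (proj₁ (realiser i)) ≡⟨ cong (col u) (proj₂ (deg u) (proj₁ (proj₂ (realiser i)))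
                                                (proj₁ (proj₂ (realiser j))) eq) ⟩
    col u (proj₁ (realiser j)) ≡⟨ proj₂ (proj₂ (realiser j)) ⟩
    col u v + toℕ j        ∎))
    where open ≡-Reasoning

V : ℕ → Set
V N = Vertex (Q N)

flip : ∀ {N} → Fin N → V N → V N
flip {suc N} F.zero    (u , x) = (u , not x)
flip {suc N} (F.suc i) (u , x) = (flip i u , x)

flip-adj : ∀ {N} (i : Fin N) (v : V N) → Adj (Q N) v (flip i v)
flip-adj {suc N} F.zero    (u , x) = inj₂ (refl , not-¬ refl)
flip-adj {suc N} (F.suc i) (u , x) = inj₁ (flip-adj i u , refl)

adj-flip : ∀ {N} {v w : V N} → Adj (Q N) v w → Σ[ i ∈ Fin N ] w ≡ flip i v
adj-flip {suc N} {u , x} {u′ , .x} (inj₁ (a , refl)) with adj-flip {N} {u} {u′} a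
... | i , refl = F.suc i , refl
adj-flip {suc N} {u , x} {.u , y} (inj₂ (refl , x≢y)) = F.zero , cong (u ,_) (¬-not (x≢y ∘ ≡-sym))

flip-injective : ∀ N (v : V N) → Injective _≡_ _≡_ (λ (i : Fin N) → flip i v)
flip-injective (suc N) (u , x) {F.zero}  {F.zero}  eq = refl
flip-injective (suc N) (u , x) {F.zero}  {F.suc j} eq = contradiction (cong proj₂ eq) (not-¬ refl ∘ ≡-sym)
flip-injective (suc N) (u , x) {F.suc i} {F.zero}  eq = contradiction (cong proj₂ eq) (not-¬ refl)
flip-injective (suc N) (u , x) {F.suc i} {F.suc j} eq = cong F.suc (flip-injective N u (cong proj₁ eq))

hypercube-degree : ∀ N → DegreeAtMost (Q N) N
hypercube-degree N u = (proj₁ ∘ adj-flip) , λ p q eq →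
  ≡-trans (proj₂ (adj-flip p)) (≡-trans (cong (λ i → flip i u) eq) (≡-sym (proj₂ (adj-flip q))))

δ : Bool → Bool → ℕ
δ true  true  = 0
δ false false = 0
δ true  false = 1
δ false true  = 1

dist : ∀ N → V N → V N → ℕ
dist zero    _       _       = 0
dist (suc N) (a , x) (v , y) = δ x y + dist N a v

dist≤ : ∀ N (a v : V N) → dist N a v ≤ N
dist≤ zero    _       _       = z≤n
dist≤ (suc N) (a , x) (v , y) with x | y
... | true  | true  = m≤n⇒m≤1+n (dist≤ N a v)
... | false | false = m≤n⇒m≤1+n (dist≤ N a v)
... | true  | false = s≤s (dist≤ N a v)
... | false | true  = s≤s (dist≤ N a v)

dist-zero : ∀ N (a v : V N) → dist N a v ≡ 0 → a ≡ v
dist-zero zero    tt          tt          _  = refl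
dist-zero (suc N) (a , true)  (v , true)  d  = cong (_, true)  (dist-zero N a v d)
dist-zero (suc N) (a , false) (v , false) d  = cong (_, false) (dist-zero N a v d)
dist-zero (suc N) (a , true)  (v , false) ()
dist-zero (suc N) (a , false) (v , true)  ()

record Descents (N : ℕ) (a v : V N) (m : ℕ) : Set where
  field
    direction           : Fin m → Fin N
    direction-injective : Injective _≡_ _≡_ direction
    closer              : ∀ j → suc (dist N a (flip (direction j) v)) ≡ m
open Descents

descents-agree : ∀ {N m a v} (x : Bool) → Descents N a v m → Descents (suc N) (a , x) (v , x) m
descents-agree {N} {m} {a} {v} x D = record
  { direction           = F.suc ∘ direction D
  ; direction-injective = direction-injective D ∘ FP.suc-injective
  ; closer              = closer′ x
  }
  where
  closer′ : ∀ x j → suc (dist (suc N) (a , x) (flip (F.suc (direction D j)) (v , x))) ≡ m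
  closer′ true  = closer D
  closer′ false = closer D

descents-differ : ∀ {N a v} (x : Bool) → Descents N a v (dist N a v) →
                  Descents (suc N) (a , x) (v , not x) (suc (dist N a v))
descents-differ {N} {a} {v} x D = record
  { direction           = g⁺
  ; direction-injective = g⁺-inj
  ; closer              = closer⁺ x
  }
  where
  g⁺ : Fin (suc (dist N a v)) → Fin (suc N)
  g⁺ F.zero    = F.zero
  g⁺ (F.suc j) = F.suc (direction D j)
  g⁺-inj : Injective _≡_ _≡_ g⁺
  g⁺-inj {F.zero}  {F.zero}  _  = refl
  g⁺-inj {F.zero}  {F.suc j} ()
  g⁺-inj {F.suc i} {F.zero}  ()
  g⁺-inj {F.suc i} {F.suc j} eq = cong F.suc (direction-injective D (FP.suc-injective eq))
  closer⁺ : ∀ x j → suc (dist (suc N) (a , x) (flip (g⁺ j) (v , not x))) ≡ suc (dist N a v)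
  closer⁺ true  F.zero    = refl
  closer⁺ false F.zero    = refl
  closer⁺ true  (F.suc j) = cong suc (closer D j)
  closer⁺ false (F.suc j) = cong suc (closer D j)

descents : ∀ N (a v : V N) → Descents N a v (dist N a v)
descents zero    a           v           = record { direction = λ () ; direction-injective = λ {} ; closer = λ () }
descents (suc N) (a , true)  (v , true)  = descents-agree  true  (descents N a v)
descents (suc N) (a , false) (v , false) = descents-agree  false (descents N a v)
descents (suc N) (a , true)  (v , false) = descents-differ true  (descents N a v)
descents (suc N) (a , false) (v , true)  = descents-differ false (descents N a v)

module DistanceBound {N t : ℕ} (C : IntervalColoring (Q N) t) where
  open IntervalColoring C

  spread : ∀ {u v w} → Adj (Q N) u v → Adj (Q N) u w → col u w < col u v + N
  spread = colour-spread (hypercube-degree N) C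

  bound : ∀ {a a′} → Adj (Q N) a a′ → col a a′ ≡ 1 →
          ∀ k v → dist N a v ≡ k → ∀ {w} → Adj (Q N) v w → col v w + tri k ≤ suc k * N
  bound {a} {a′} aa′ col≡1 zero v d {w} vw with dist-zero N a v d
  ... | refl = begin
    col a w + 0 ≡⟨ +-identityʳ _ ⟩
    col a w     ≤⟨ ≤-pred (subst (λ c → col a w < c + N) col≡1 (spread aa′ vw)) ⟩
    N           ≡⟨ ≡-sym (+-identityʳ N) ⟩
    1 * N       ∎
    where open ≤-Reasoning
  bound {a} aa′ col≡1 (suc k) v d {w} vw = begin
    col v w + (suc k + tri k)     ≡⟨ +-suc (col v w) (k + tri k) ⟩
    suc (col v w) + (k + tri k)   ≤⟨ +-monoˡ-≤ (k + tri k) (spread (flip-adj (g j) v) vw) ⟩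
    (c j + N) + (k + tri k)       ≡⟨ solve 4 (λ c n k s → (c :+ n) :+ (k :+ s) := n :+ (c :+ s :+ k))
                                       refl (c j) N k (tri k) ⟩
    N + (c j + tri k + k)         ≤⟨ +-monoʳ-≤ N (proj₂ lowest) ⟩
    N + suc k * N                 ∎
    where
    open ≤-Reasoning
    desc : Descents N a v (suc k)
    desc = subst (Descents N a v) d (descents N a v)
    g : Fin (suc k) → Fin N
    g = direction desc
    c : Fin (suc k) → ℕ
    c j = col v (flip (g j) v)
    c-inj : Injective _≡_ _≡_ (λ j → c j + tri k)
    c-inj {i} {j} eq with i FP.≟ j
    ... | yes i≡j = i≡j
    ... | no  i≢j = contradiction (+-cancelʳ-≡ (tri k) _ _ eq)
          (proper v _ _ (flip-adj (g i) v) (flip-adj (g j) v)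
            (i≢j ∘ direction-injective desc ∘ flip-injective N v))
    c≤ : ∀ j → c j + tri k ≤ suc k * N
    c≤ j = subst (λ x → x + tri k ≤ suc k * N)
             (≡-sym (col-sym v _ (flip-adj (g j) v)))
             (bound aa′ col≡1 k (flip (g j) v) (suc-injective (closer desc j))
               (Graph.sym (Q N) (flip-adj (g j) v)))
    lowest : ∃[ j ] (c j + tri k + k ≤ suc k * N)
    lowest = spread-of-distinct (λ j → c j + tri k) c-inj c≤
    j : Fin (suc k)
    j = proj₁ lowest

-- W(Q N) ≤ tri N: the edge of colour t lies at distance k ≤ N from an edge
-- of colour 1, so t ≤ (k+1)N - tri k ≤ tri N.
hypercube-W≤ : ∀ N → W≤ (Q N) (tri N)
hypercube-W≤ N zero    C = z≤n
hypercube-W≤ N (suc t) C with surj 1 (s≤s z≤n) (s≤s z≤n) | surj (suc t) (s≤s z≤n) ≤-refl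
  where open IntervalColoring C
... | a , a′ , aa′ , col≡1 | b , b′ , bb′ , col≡t =
  +-cancelˡ-≤ (tri k) _ _ (begin
    tri k + suc t      ≡⟨ +-comm (tri k) _ ⟩
    suc t + tri k      ≤⟨ subst (λ c → c + tri k ≤ suc k * N) col≡t (bound aa′ col≡1 k b refl bb′) ⟩
    suc k * N          ≤⟨ peak (dist≤ N a b) ⟩
    tri k + tri N      ∎)
  where
  open ≤-Reasoning
  open DistanceBound {N} C
  k : ℕ
  k = dist N a b

corollary7 : (n : ℕ) → W≤ (Q (suc n)) ((suc n * suc (suc n)) / 2)
corollary7 n t C = subst (t ≤_) (≡-sym (tri-div (suc n))) (hypercube-W≤ (suc n) t C)
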